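{- Every connected component of $\mathsf{FS}(\mathsf{Cycle}_n,\mathsf{Star}_n)$ is isomorphic to $\mathsf{Cycle}_{n(n-1)}$.
   Context: For simple graphs $X,Y$ on $n$ vertices, $\mathsf{FS}(X,Y)$ has as vertices all bijections $V(X)\to V(Y)$, with $\sigma,\tau$ adjacent iff there is an edge $\{a,b\}\in E(X)$ such that $\{\sigma(a),\sigma(b)\}\in E(Y)$, $\tau(a)=\sigma(b)$, $\tau(b)=\sigma(a)$, and $\tau(c)=\sigma(c)$ for all other $c$. $\mathsf{Cycle}_m$ is the cycle on $[m]$ with edges $\{i,i+1\}$ for $i\in[m-1]$ and $\{m,1\}$ (here $n\geq 3$). $\mathsf{Star}_n=K_{1,n-1}$ is the star graph on $n$ vertices. -}

module Defs where

open import Data.Nat using (ℕ; zero; suc; _∸_; _*_; _≤_)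
open import Data.Fin using (Fin; toℕ)
open import Data.Product using (Σ; ∃; ∃-syntax; _×_; _,_)
open import Data.Sum using (_⊎_)
open import Relation.Binary.PropositionalEquality using (_≡_; _≢_)
open import Function.Definitions using (Bijective)
open import Function.Bundles using (_⇔_)

Adj : ℕ → Set₁
Adj n = Fin n → Fin n → Set

CycStep : (m : ℕ) → Adj m
CycStep m i j = (suc (toℕ i) ≡ toℕ j) ⊎ (suc (toℕ i) ≡ m × toℕ j ≡ 0)

-- Cycle_m : edges {i, i+1} and {m-1, 0}  (vertex k here = vertex k+1 in the paper)
Cycle : (m : ℕ) → Adj m
Cycle m i j = CycStep m i j ⊎ CycStep m j i

Star : (n : ℕ) → Adj n
Star n a b = (toℕ a ≡ 0 × toℕ b ≢ 0) ⊎ (toℕ b ≡ 0 × toℕ a ≢ 0)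

-- Vertices of FS(X,Y): bijections V(X) → V(Y)
Bij : ℕ → Set
Bij n = Σ (Fin n → Fin n) (Bijective _≡_ _≡_)

fun : ∀ {n} → Bij n → Fin n → Fin n
fun (σ , _) = σ

_≈_ : ∀ {n} → Bij n → Bij n → Set
σ ≈ τ = ∀ x → fun σ x ≡ fun τ x

FS : ∀ {n} → Adj n → Adj n → Bij n → Bij n → Set
FS X Y σ τ =
  ∃[ a ] ∃[ b ] (X a b × Y (fun σ a) (fun σ b)
    × fun τ a ≡ fun σ b × fun τ b ≡ fun σ a
    × (∀ c → c ≢ a → c ≢ b → fun τ c ≡ fun σ c))

data Reach {n} (X Y : Adj n) : Bij n → Bij n → Set where
  here : ∀ {σ τ} → σ ≈ τ → Reach X Y σ τ
  step : ∀ {σ τ ρ} → Reach X Y σ τ → FS X Y τ ρ → Reach X Y σ ρ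

ComponentIsoCycle : ∀ {n} → Adj n → Adj n → Bij n → ℕ → Set
ComponentIsoCycle {n} X Y σ₀ m =
  Σ (Fin m → Bij n) λ f →
      (∀ i → Reach X Y σ₀ (f i))
    × (∀ τ → Reach X Y σ₀ τ → ∃[ i ] (f i ≈ τ))
    × (∀ i j → f i ≈ f j → i ≡ j)
    × (∀ i j → Cycle m i j ⇔ FS X Y (f i) (f j))

-- A move of FS(Cycle n, Star n) swaps the token sitting at the centre of the star with the token
-- on a cycle-neighbour of its position. Let F k be the configuration reached from σ₀ by moving the
-- centre token forward k times: its position is then c₀ + k, while the other n − 1 tokens have been
-- rotated by k places along the remaining positions. Each F k has exactly the two neighbours
-- F (k ± 1), so the component of σ₀ is traced out by F. The walk is periodic with period n(n − 1),
-- and F a = F b forces a ≡ b modulo n (position of the centre) and modulo n − 1 (token following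
-- the centre), hence modulo n(n − 1) since n and n − 1 are coprime.
module Submission where

open import Defs
open import Data.Nat using (ℕ; zero; suc; _+_; _*_; _∸_; _≤_; _<_; z≤n; s≤s; z<s; NonZero; ∣_-_∣)
open import Data.Nat.Properties hiding (_≟_)
open import Algebra.Properties.CommutativeSemigroup +-commutativeSemigroup using (x∙yz≈y∙xz)
open import Data.Nat.DivMod
open import Data.Nat.Divisibility
open import Data.Nat.Coprimality using (Coprime; coprime-divisor; coprime-+; 1-coprimeTo)
open import Data.Fin using (Fin; toℕ; zero; _≟_)
open import Data.Fin.Properties using (toℕ<n; toℕ-fromℕ<; toℕ-injective)
open import Data.Fin.Permutation using () renaming (transpose to transposition)
open import Data.Fin.Permutation.Components using (transpose; transpose-inverse)
open import Data.Product using (∃-syntax; _×_; _,_; proj₁; proj₂)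
open import Data.Sum using (_⊎_; inj₁; inj₂; swap)
open import Function using (_∘_)
open import Function.Bundles using (_⇔_; mk⇔; Equivalence; Bijection)
open import Function.Properties.Inverse using (↔⇒⤖)
import Function.Construct.Composition as Compose
open import Relation.Binary.Definitions using (Symmetric)
open import Relation.Nullary using (yes; no)
open import Relation.Nullary.Decidable using (dec-true; dec-false)
open import Relation.Binary.PropositionalEquality

%-≡⇒∣∸ : ∀ a b d .{{_ : NonZero d}} → a % d ≡ b % d → d ∣ a ∸ b
%-≡⇒∣∸ a b d eq = divides (a / d ∸ b / d) (begin
  a ∸ b                                     ≡⟨ cong₂ _∸_ (m≡m%n+[m/n]*n a d) (m≡m%n+[m/n]*n b d) ⟩
  (a % d + a / d * d) ∸ (b % d + b / d * d) ≡⟨ cong (λ r → (r + a / d * d) ∸ (b % d + b / d * d)) eq ⟩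
  (b % d + a / d * d) ∸ (b % d + b / d * d) ≡⟨ [m+n]∸[m+o]≡n∸o (b % d) _ _ ⟩
  a / d * d ∸ b / d * d                     ≡⟨ *-distribʳ-∸ d (a / d) (b / d) ⟨
  (a / d ∸ b / d) * d                       ∎)
  where open ≡-Reasoning

%-≡⇒∣∣-∣ : ∀ a b d .{{_ : NonZero d}} → a % d ≡ b % d → d ∣ ∣ a - b ∣
%-≡⇒∣∣-∣ a b d eq with ∣m-n∣≡[m∸n]∨[n∸m] a b
... | inj₁ e = subst (d ∣_) (sym e) (%-≡⇒∣∸ a b d eq)
... | inj₂ e = subst (d ∣_) (sym e) (%-≡⇒∣∸ b a d (sym eq))

∣∸⇒%-≡ : ∀ {a b} d .{{_ : NonZero d}} → a ≤ b → d ∣ b ∸ a → b % d ≡ a % d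
∣∸⇒%-≡ {a} {b} d a≤b (divides q eq) = begin
  b % d               ≡⟨ cong (_% d) (m+[n∸m]≡n a≤b) ⟨
  (a + (b ∸ a)) % d   ≡⟨ cong (λ t → (a + t) % d) eq ⟩
  (a + q * d) % d     ≡⟨ [m+kn]%n≡m%n a q d ⟩
  a % d               ∎
  where open ≡-Reasoning

∣∣-∣⇒%-≡ : ∀ a b d .{{_ : NonZero d}} → d ∣ ∣ a - b ∣ → a % d ≡ b % d
∣∣-∣⇒%-≡ a b d d∣ with ≤-total a b
... | inj₁ a≤b = sym (∣∸⇒%-≡ d a≤b (subst (d ∣_) (m≤n⇒∣m-n∣≡n∸m a≤b) d∣))
... | inj₂ b≤a = ∣∸⇒%-≡ d b≤a
  (subst (d ∣_) (trans (∣-∣-comm a b) (m≤n⇒∣m-n∣≡n∸m b≤a)) d∣)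

+-%-cancelˡ : ∀ x a b d .{{_ : NonZero d}} → (x + a) % d ≡ (x + b) % d → a % d ≡ b % d
+-%-cancelˡ x a b d eq =
  ∣∣-∣⇒%-≡ a b d (subst (d ∣_) (∣m+n-m+o∣≡∣n-o∣ x a b) (%-≡⇒∣∣-∣ (x + a) (x + b) d eq))

+-%-congˡ : ∀ x a b d .{{_ : NonZero d}} → a % d ≡ b % d → (x + a) % d ≡ (x + b) % d
+-%-congˡ x a b d eq =
  ∣∣-∣⇒%-≡ (x + a) (x + b) d (subst (d ∣_) (sym (∣m+n-m+o∣≡∣n-o∣ x a b)) (%-≡⇒∣∣-∣ a b d eq))

+-%-congʳ : ∀ x a b d .{{_ : NonZero d}} → a % d ≡ b % d → (a + x) % d ≡ (b + x) % d
+-%-congʳ x a b d eq = subst₂ (λ u v → u % d ≡ v % d) (+-comm x a) (+-comm x b) (+-%-congˡ x a b d eq)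

%-≡∧<⇒≡ : ∀ {a b} d .{{_ : NonZero d}} → a < d → b < d → a % d ≡ b % d → a ≡ b
%-≡∧<⇒≡ d a<d b<d eq = trans (sym (m<n⇒m%n≡m a<d)) (trans eq (m<n⇒m%n≡m b<d))

coprime-∣∧∣⇒*∣ : ∀ {m n k} → Coprime m n → m ∣ k → n ∣ k → m * n ∣ k
coprime-∣∧∣⇒*∣ {m} {n} coprime m∣k (divides q refl) =
  *-monoˡ-∣ n (coprime-divisor coprime (subst (m ∣_) (*-comm q n) m∣k))

%-≡-chinese : ∀ a b m n .{{_ : NonZero m}} .{{_ : NonZero n}} .{{_ : NonZero (m * n)}} →
              Coprime m n →
              a % m ≡ b % m → a % n ≡ b % n → a % (m * n) ≡ b % (m * n)
%-≡-chinese a b m n coprime eqₘ eqₙ = ∣∣-∣⇒%-≡ a b (m * n)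
  (coprime-∣∧∣⇒*∣ coprime (%-≡⇒∣∣-∣ a b m eqₘ) (%-≡⇒∣∣-∣ a b n eqₙ))

%-offset-exists : ∀ y {x} d .{{_ : NonZero d}} → x < d → ∃[ e ] e < d × (y + e) % d ≡ x
%-offset-exists y {x} d x<d = e , m%n<n _ d , (begin
  (y + e) % d                        ≡⟨ +-%-congˡ y _ _ d (m%n%n≡m%n (x + (d ∸ y % d)) d) ⟩
  (y + (x + (d ∸ y % d))) % d        ≡⟨ +-%-congʳ (x + (d ∸ y % d)) (y % d) y d (m%n%n≡m%n y d) ⟨
  (y % d + (x + (d ∸ y % d))) % d    ≡⟨ cong (_% d) (x∙yz≈y∙xz (y % d) x _) ⟩
  (x + (y % d + (d ∸ y % d))) % d    ≡⟨ cong (λ t → (x + t) % d) (m+[n∸m]≡n (<⇒≤ (m%n<n y d))) ⟩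
  (x + d) % d                        ≡⟨ [m+n]%n≡m%n x d ⟩
  x % d                              ≡⟨ m<n⇒m%n≡m x<d ⟩
  x                                  ∎)
  where
  open ≡-Reasoning
  e : ℕ
  e = (x + (d ∸ y % d)) % d

suc-coprimeTo : ∀ m → Coprime (suc m) m
suc-coprimeTo m = subst (λ k → Coprime k m) (+-comm m 1) (coprime-+ (1-coprimeTo m))

CycStep⇔suc-% : ∀ {N} .{{_ : NonZero N}} (i j : Fin N) → CycStep N i j ⇔ toℕ j ≡ suc (toℕ i) % N
CycStep⇔suc-% {N} i j = mk⇔ to from
  where
  to : CycStep N i j → toℕ j ≡ suc (toℕ i) % N
  to (inj₁ i+1≡j)         = sym (trans (m<n⇒m%n≡m (subst (_< N) (sym i+1≡j) (toℕ<n j))) i+1≡j)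
  to (inj₂ (i+1≡N , j≡0)) = trans j≡0 (sym (trans (cong (_% N) i+1≡N) (n%n≡0 N)))
  from : toℕ j ≡ suc (toℕ i) % N → CycStep N i j
  from j≡ with m≤n⇒m<n∨m≡n (toℕ<n i)
  ... | inj₁ i+1<N = inj₁ (sym (trans j≡ (m<n⇒m%n≡m i+1<N)))
  ... | inj₂ i+1≡N = inj₂ (i+1≡N , trans j≡ (trans (cong (_% N) i+1≡N) (n%n≡0 N)))

module _ {n : ℕ} where

  transpose-matchˡ : ∀ (i j : Fin n) → transpose i j i ≡ j
  transpose-matchˡ i j rewrite dec-true (i ≟ i) refl = refl

  transpose-matchʳ : ∀ (i j : Fin n) → transpose i j j ≡ i
  transpose-matchʳ i j with j ≟ i
  ... | yes j≡i = j≡i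
  ... | no _ rewrite dec-true (j ≟ j) refl = refl

  transpose-other : ∀ {i j k : Fin n} → k ≢ i → k ≢ j → transpose i j k ≡ k
  transpose-other {i} {j} {k} k≢i k≢j rewrite dec-false (k ≟ i) k≢i | dec-false (k ≟ j) k≢j = refl

  -- Splitting on `x ≟ y` directly would abstract that test inside `transpose` as well.
  private
    ≡-or-≢ : (x y : Fin n) → x ≡ y ⊎ x ≢ y
    ≡-or-≢ x y with x ≟ y
    ... | yes x≡y = inj₁ x≡y
    ... | no x≢y  = inj₂ x≢y

  transpose-comm : ∀ (i j k : Fin n) → transpose i j k ≡ transpose j i k
  transpose-comm i j k with ≡-or-≢ k i | ≡-or-≢ k j
  ... | inj₁ refl | _         = trans (transpose-matchˡ k j) (sym (transpose-matchʳ j k))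
  ... | inj₂ _    | inj₁ refl = trans (transpose-matchʳ i k) (sym (transpose-matchˡ k i))
  ... | inj₂ k≢i  | inj₂ k≢j  = trans (transpose-other k≢i k≢j) (sym (transpose-other k≢j k≢i))

  infixl 30 _∘⟨_⇄_⟩
  _∘⟨_⇄_⟩ : Bij n → Fin n → Fin n → Bij n
  σ ∘⟨ a ⇄ b ⟩ = fun σ ∘ transpose a b
    , Compose.bijective _≡_ _≡_ _≡_ (Bijection.bijective (↔⇒⤖ (transposition a b))) (proj₂ σ)

  FS-resp : ∀ {X Y : Adj n} {σ σ′ τ τ′} → σ ≈ σ′ → τ ≈ τ′ → FS X Y σ τ → FS X Y σ′ τ′
  FS-resp {Y = Y} σ≈ τ≈ (a , b , Xab , Yab , τa , τb , τc) =
    a , b , Xab , subst₂ Y (σ≈ a) (σ≈ b) Yab ,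
    trans (sym (τ≈ a)) (trans τa (σ≈ b)) , trans (sym (τ≈ b)) (trans τb (σ≈ a)) ,
    λ c c≢a c≢b → trans (sym (τ≈ c)) (trans (τc c c≢a c≢b) (σ≈ c))

  FS-sym : ∀ {X Y : Adj n} → Symmetric Y → ∀ {σ τ} → FS X Y σ τ → FS X Y τ σ
  FS-sym {Y = Y} Y-sym (a , b , Xab , Yab , τa , τb , τc) =
    a , b , Xab , subst₂ Y (sym τa) (sym τb) (Y-sym Yab) , sym τb , sym τa ,
    λ c c≢a c≢b → sym (τc c c≢a c≢b)

  transpose⇒FS : ∀ {X Y : Adj n} {σ a b} → X a b → Y (fun σ a) (fun σ b) →
                 FS X Y σ (σ ∘⟨ a ⇄ b ⟩)
  transpose⇒FS {σ = σ} {a} {b} Xab Yab =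
    a , b , Xab , Yab , cong (fun σ) (transpose-matchˡ a b) , cong (fun σ) (transpose-matchʳ a b) ,
    λ c c≢a c≢b → cong (fun σ) (transpose-other c≢a c≢b)

  FS⇒transpose : ∀ {X Y : Adj n} {σ τ} → FS X Y σ τ →
                 ∃[ a ] ∃[ b ] X a b × Y (fun σ a) (fun σ b) × τ ≈ σ ∘⟨ a ⇄ b ⟩
  FS⇒transpose {σ = σ} {τ} (a , b , Xab , Yab , τa , τb , τc) = a , b , Xab , Yab , τ≈
    where
    τ≈ : τ ≈ σ ∘⟨ a ⇄ b ⟩
    τ≈ c with ≡-or-≢ c a | ≡-or-≢ c b
    ... | inj₁ refl | _         = trans τa (cong (fun σ) (sym (transpose-matchˡ c b)))
    ... | inj₂ _    | inj₁ refl = trans τb (cong (fun σ) (sym (transpose-matchʳ a c)))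
    ... | inj₂ c≢a  | inj₂ c≢b  = trans (τc c c≢a c≢b) (cong (fun σ) (sym (transpose-other c≢a c≢b)))

module CyclicWalk {n} {X Y : Adj n} (Y-sym : Symmetric Y) (N : ℕ) (W : ℕ → Bij n)
  (walk : ∀ k → FS X Y (W k) (W (suc k)))
  (periodic : ∀ k → W (suc N + k) ≈ W k)
  (forward-or-back : ∀ k ρ → FS X Y (W (suc k)) ρ → ρ ≈ W (suc (suc k)) ⊎ ρ ≈ W k)
  (W-injective : ∀ a b → W a ≈ W b → a % suc N ≡ b % suc N)
  where

  private
    P : ℕ
    P = suc N

    W-cong : ∀ {a b} → a ≡ b → W a ≈ W b
    W-cong refl _ = refl

  W-+periods : ∀ q r → W (q * P + r) ≈ W r
  W-+periods zero    r = λ _ → refl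
  W-+periods (suc q) r x =
    trans (W-cong (+-assoc P (q * P) r) x) (trans (periodic (q * P + r) x) (W-+periods q r x))

  W-mod : ∀ k → W k ≈ W (toℕ (k mod P))
  W-mod k x = trans (W-cong (trans (m≡m%n+[m/n]*n k P) (+-comm (k % P) _)) x)
    (trans (W-+periods (k / P) (k % P) x) (W-cong (sym (toℕ-fromℕ< _)) x))

  W-neighbours : ∀ k σ ρ → W k ≈ σ → FS X Y σ ρ → ρ ≈ W (suc k) ⊎ ρ ≈ W (N + k)
  W-neighbours k σ ρ k≈σ fs
    with forward-or-back (N + k) ρ
           (FS-resp {X = X} {Y} {σ} {W (suc N + k)} {ρ} {ρ}
             (λ x → trans (sym (k≈σ x)) (sym (periodic k x))) (λ _ → refl) fs)
  ... | inj₁ ρ≈ = inj₁ λ x →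
          trans (ρ≈ x) (trans (W-cong (cong suc (sym (+-suc N k))) x) (periodic (suc k) x))
  ... | inj₂ ρ≈ = inj₂ ρ≈

  vertex : Fin P → Bij n
  vertex i = W (toℕ i)

  reachable : ∀ k → Reach X Y (W 0) (W k)
  reachable zero    = here λ _ → refl
  reachable (suc k) = step (reachable k) (walk k)

  covers : ∀ τ → Reach X Y (W 0) τ → ∃[ i ] vertex i ≈ τ
  covers τ (here W0≈τ) = zero , W0≈τ
  covers ρ (step {τ = τ} r fs) with covers τ r
  ... | i , i≈τ with W-neighbours (toℕ i) τ ρ i≈τ fs
  ... | inj₁ ρ≈ = suc (toℕ i) mod P , λ x → sym (trans (ρ≈ x) (W-mod _ x))
  ... | inj₂ ρ≈ = (N + toℕ i) mod P , λ x → sym (trans (ρ≈ x) (W-mod _ x))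

  vertex-injective : ∀ i j → vertex i ≈ vertex j → i ≡ j
  vertex-injective i j i≈j = toℕ-injective (%-≡∧<⇒≡ P (toℕ<n i) (toℕ<n j) (W-injective _ _ i≈j))

  CycStep⇒FS : ∀ i j → CycStep P i j → FS X Y (vertex i) (vertex j)
  CycStep⇒FS i j i→j = FS-resp {X = X} {Y} {vertex i} {vertex i} {W (suc (toℕ i))} {vertex j}
    (λ _ → refl) (λ x → trans (W-mod (suc (toℕ i)) x) (W-cong (sym toℕj≡) x)) (walk (toℕ i))
    where
    toℕj≡ : toℕ j ≡ toℕ (suc (toℕ i) mod P)
    toℕj≡ = trans (Equivalence.to (CycStep⇔suc-% i j) i→j) (sym (toℕ-fromℕ< _))

  Cycle⇒FS : ∀ i j → Cycle P i j → FS X Y (vertex i) (vertex j)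
  Cycle⇒FS i j (inj₁ i→j) = CycStep⇒FS i j i→j
  Cycle⇒FS i j (inj₂ j→i) = FS-sym {X = X} {Y} Y-sym {vertex j} {vertex i} (CycStep⇒FS j i j→i)

  FS⇒Cycle : ∀ i j → FS X Y (vertex i) (vertex j) → Cycle P i j
  FS⇒Cycle i j fs with W-neighbours (toℕ i) (vertex i) (vertex j) (λ _ → refl) fs
  ... | inj₁ j≈ = inj₁ (Equivalence.from (CycStep⇔suc-% i j)
        (trans (sym (m<n⇒m%n≡m (toℕ<n j))) (W-injective _ _ j≈)))
  ... | inj₂ j≈ = inj₂ (Equivalence.from (CycStep⇔suc-% j i) (begin
        toℕ i                    ≡⟨ m<n⇒m%n≡m (toℕ<n i) ⟨
        toℕ i % P                ≡⟨ %-remove-+ˡ (toℕ i) ∣-refl ⟨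
        (1 + (N + toℕ i)) % P    ≡⟨ +-%-congˡ 1 (toℕ j) (N + toℕ i) P (W-injective _ _ j≈) ⟨
        suc (toℕ j) % P          ∎))
    where open ≡-Reasoning

  component : ComponentIsoCycle X Y (W 0) P
  component = vertex , (λ i → reachable (toℕ i)) , covers , vertex-injective ,
    λ i j → mk⇔ (Cycle⇒FS i j) (FS⇒Cycle i j)

module CentreWalk (j : ℕ) (σ₀ : Bij (3 + j)) where

  m n : ℕ
  m = 2 + j
  n = suc m

  centre₀ : Fin n
  centre₀ = proj₁ (proj₂ (proj₂ σ₀) zero)

  σ₀-centre₀ : fun σ₀ centre₀ ≡ zero
  σ₀-centre₀ = proj₂ (proj₂ (proj₂ σ₀) zero) refl

  c₀ : ℕ
  c₀ = toℕ centre₀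

  pos : ℕ → Fin n
  pos t = (c₀ + t) mod n

  toℕ-pos : ∀ t → toℕ (pos t) ≡ (c₀ + t) % n
  toℕ-pos t = toℕ-fromℕ< _

  toℕ-pos-% : ∀ t → toℕ (pos t) % n ≡ (c₀ + t) % n
  toℕ-pos-% t = trans (cong (_% n) (toℕ-pos t)) (m%n%n≡m%n (c₀ + t) n)

  pos-cong : ∀ t u → t % n ≡ u % n → pos t ≡ pos u
  pos-cong t u eq = toℕ-injective (trans (toℕ-pos t) (trans (+-%-congˡ c₀ t u n eq) (sym (toℕ-pos u))))

  pos-injective : ∀ t u → pos t ≡ pos u → t % n ≡ u % n
  pos-injective t u eq = +-%-cancelˡ c₀ t u n (trans (sym (toℕ-pos t)) (trans (cong toℕ eq) (toℕ-pos u)))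

  pos-offset-injective : ∀ t a b → a < n → b < n → pos (t + a) ≡ pos (t + b) → a ≡ b
  pos-offset-injective t a b a<n b<n eq =
    %-≡∧<⇒≡ n a<n b<n (+-%-cancelˡ t a b n (pos-injective (t + a) (t + b) eq))

  pos-0 : pos 0 ≡ centre₀
  pos-0 = toℕ-injective
    (trans (toℕ-pos 0) (trans (cong (_% n) (+-identityʳ c₀)) (m<n⇒m%n≡m (toℕ<n centre₀))))

  pos-+n : ∀ t → pos (t + n) ≡ pos t
  pos-+n t = pos-cong (t + n) t ([m+n]%n≡m%n t n)

  pos-+period : ∀ t → pos (n * m + t) ≡ pos t
  pos-+period t = pos-cong (n * m + t) t (%-remove-+ˡ t (m∣m*n m))

  pos-surjective : ∀ t x → ∃[ e ] e < n × pos (t + e) ≡ x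
  pos-surjective t x with %-offset-exists (c₀ + t) n (toℕ<n x)
  ... | e , e<n , eq =
    e , e<n , toℕ-injective (trans (toℕ-pos (t + e)) (trans (cong (_% n) (sym (+-assoc c₀ t e))) eq))

  suc-toℕ-pos : ∀ t → suc (toℕ (pos t)) % n ≡ toℕ (pos (suc t))
  suc-toℕ-pos t = begin
    (1 + toℕ (pos t)) % n   ≡⟨ +-%-congˡ 1 (toℕ (pos t)) (c₀ + t) n (toℕ-pos-% t) ⟩
    (1 + (c₀ + t)) % n      ≡⟨ cong (_% n) (+-suc c₀ t) ⟨
    (c₀ + suc t) % n        ≡⟨ toℕ-pos (suc t) ⟨
    toℕ (pos (suc t))       ∎
    where open ≡-Reasoning

  pos-next : ∀ t → CycStep n (pos t) (pos (suc t))
  pos-next t = Equivalence.from (CycStep⇔suc-% (pos t) (pos (suc t))) (sym (suc-toℕ-pos t))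

  pos-prev : ∀ t q → CycStep n q (pos t) → q ≡ pos (t + m)
  pos-prev t q q→t = toℕ-injective (begin
    toℕ q                   ≡⟨ m<n⇒m%n≡m (toℕ<n q) ⟨
    toℕ q % n               ≡⟨ %-remove-+ˡ (toℕ q) ∣-refl ⟨
    (n + toℕ q) % n         ≡⟨ cong (_% n) (+-suc m (toℕ q)) ⟨
    (m + suc (toℕ q)) % n   ≡⟨ +-%-congˡ m (suc (toℕ q)) (toℕ (pos t)) n q+1≡t ⟩
    (m + toℕ (pos t)) % n   ≡⟨ +-%-congˡ m (toℕ (pos t)) (c₀ + t) n (toℕ-pos-% t) ⟩
    (m + (c₀ + t)) % n      ≡⟨ cong (_% n) (trans (x∙yz≈y∙xz m c₀ t) (cong (c₀ +_) (+-comm m t))) ⟩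
    (c₀ + (t + m)) % n      ≡⟨ toℕ-pos (t + m) ⟨
    toℕ (pos (t + m))       ∎)
    where
    open ≡-Reasoning
    q+1≡t : suc (toℕ q) % n ≡ toℕ (pos t) % n
    q+1≡t = sym (trans (cong (_% n) (Equivalence.to (CycStep⇔suc-% q (pos t)) q→t))
                       (m%n%n≡m%n (suc (toℕ q)) n))

  pos-neighbours : ∀ t q → Cycle n (pos t) q → q ≡ pos (suc t) ⊎ q ≡ pos (t + m)
  pos-neighbours t q (inj₁ t→q) =
    inj₁ (toℕ-injective (trans (Equivalence.to (CycStep⇔suc-% (pos t) q) t→q) (suc-toℕ-pos t)))
  pos-neighbours t q (inj₂ q→t) = inj₂ (pos-prev t q q→t)

  F : ℕ → Bij n
  F zero    = σ₀
  F (suc k) = F k ∘⟨ pos k ⇄ pos (suc k) ⟩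

  origin : ℕ → ℕ → ℕ
  origin k zero    = 0
  origin k (suc e) = suc ((e + k) % m)

  F-suc-centre : ∀ k → fun (F (suc k)) (pos (suc k)) ≡ fun (F k) (pos k)
  F-suc-centre k = cong (fun (F k)) (transpose-matchʳ (pos k) (pos (suc k)))

  F-suc-behind : ∀ k → fun (F (suc k)) (pos (k + n)) ≡ fun (F k) (pos (suc k))
  F-suc-behind k = cong (fun (F k))
    (trans (cong (transpose (pos k) (pos (suc k))) (pos-+n k)) (transpose-matchˡ (pos k) (pos (suc k))))

  F-suc-other : ∀ k e → suc e < m →
                fun (F (suc k)) (pos (k + suc (suc e))) ≡ fun (F k) (pos (k + suc (suc e)))
  F-suc-other k e e+1<m = cong (fun (F k)) (transpose-other ≢pos-k ≢pos-k+1)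
    where
    ≢pos-k : pos (k + suc (suc e)) ≢ pos k
    ≢pos-k eq with pos-offset-injective k (suc (suc e)) 0 (s≤s e+1<m) z<s
                     (trans eq (cong pos (sym (+-identityʳ k))))
    ... | ()
    ≢pos-k+1 : pos (k + suc (suc e)) ≢ pos (suc k)
    ≢pos-k+1 eq with pos-offset-injective k (suc (suc e)) 1 (s≤s e+1<m) (s≤s z<s)
                       (trans eq (cong pos (+-comm 1 k)))
    ... | ()

  F-pos : ∀ k e → e < n → fun (F k) (pos (k + e)) ≡ fun σ₀ (pos (origin k e))
  F-pos zero    zero    _         = refl
  F-pos zero    (suc e) (s≤s e<m) =
    cong (λ t → fun σ₀ (pos (suc t))) (sym (trans (cong (_% m) (+-identityʳ e)) (m<n⇒m%n≡m e<m)))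
  F-pos (suc k) zero    _         = begin
    fun (F (suc k)) (pos (suc k + 0))   ≡⟨ cong (fun (F (suc k)) ∘ pos) (+-identityʳ (suc k)) ⟩
    fun (F (suc k)) (pos (suc k))       ≡⟨ F-suc-centre k ⟩
    fun (F k) (pos k)                   ≡⟨ cong (fun (F k) ∘ pos) (+-identityʳ k) ⟨
    fun (F k) (pos (k + 0))             ≡⟨ F-pos k 0 z<s ⟩
    fun σ₀ (pos 0)                      ∎
    where open ≡-Reasoning
  F-pos (suc k) (suc e) (s≤s e<m) with m≤n⇒m<n∨m≡n e<m
  ... | inj₁ e+1<m = begin
    fun (F (suc k)) (pos (suc k + suc e))      ≡⟨ cong (fun (F (suc k)) ∘ pos) (+-suc k (suc e)) ⟨
    fun (F (suc k)) (pos (k + suc (suc e)))    ≡⟨ F-suc-other k e e+1<m ⟩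
    fun (F k) (pos (k + suc (suc e)))          ≡⟨ F-pos k (suc (suc e)) (s≤s e+1<m) ⟩
    fun σ₀ (pos (suc ((suc e + k) % m)))       ≡⟨ cong (λ t → fun σ₀ (pos (suc (t % m)))) (+-suc e k) ⟨
    fun σ₀ (pos (suc ((e + suc k) % m)))       ∎
    where open ≡-Reasoning
  ... | inj₂ refl = begin
    fun (F (suc k)) (pos (suc k + suc e))      ≡⟨ cong (fun (F (suc k)) ∘ pos) (+-suc k (suc e)) ⟨
    fun (F (suc k)) (pos (k + n))              ≡⟨ F-suc-behind k ⟩
    fun (F k) (pos (suc k))                    ≡⟨ cong (fun (F k) ∘ pos) (+-comm 1 k) ⟩
    fun (F k) (pos (k + 1))                    ≡⟨ F-pos k 1 (s≤s z<s) ⟩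
    fun σ₀ (pos (suc (k % m)))                 ≡⟨ cong (λ t → fun σ₀ (pos (suc t))) m+k%m≡k%m ⟨
    fun σ₀ (pos (suc ((e + suc k) % m)))       ∎
    where
    open ≡-Reasoning
    m+k%m≡k%m : (e + suc k) % m ≡ k % m
    m+k%m≡k%m = trans (cong (_% m) (+-suc e k)) (%-remove-+ˡ k ∣-refl)

  F-centre : ∀ k → fun (F k) (pos k) ≡ zero
  F-centre k = begin
    fun (F k) (pos k)         ≡⟨ cong (fun (F k) ∘ pos) (+-identityʳ k) ⟨
    fun (F k) (pos (k + 0))   ≡⟨ F-pos k 0 z<s ⟩
    fun σ₀ (pos 0)            ≡⟨ cong (fun σ₀) pos-0 ⟩
    fun σ₀ centre₀            ≡⟨ σ₀-centre₀ ⟩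
    zero                      ∎
    where open ≡-Reasoning

  F-centre-unique : ∀ k x → toℕ (fun (F k) x) ≡ 0 → x ≡ pos k
  F-centre-unique k x x↦0 = proj₁ (proj₂ (F k)) (trans (toℕ-injective x↦0) (sym (F-centre k)))

  F-step : ∀ k → FS (Cycle n) (Star n) (F k) (F (suc k))
  F-step k = transpose⇒FS {X = Cycle n} {Star n} {F k} (inj₁ (pos-next k))
    (inj₁ (cong toℕ (F-centre k) , next-not-centre))
    where
    next-not-centre : toℕ (fun (F k) (pos (suc k))) ≢ 0
    next-not-centre k+1↦0 with pos-offset-injective k 1 0 (s≤s z<s) z<s
      (trans (cong pos (+-comm k 1)) (trans (F-centre-unique k _ k+1↦0) (cong pos (sym (+-identityʳ k)))))
    ... | ()

  F-centre-moves : ∀ k q ρ → Cycle n (pos k) q → ρ ≈ F k ∘⟨ pos k ⇄ q ⟩ →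
                   ρ ≈ F (suc k) ⊎ ρ ≈ F k ∘⟨ pos k ⇄ pos (k + m) ⟩
  F-centre-moves k q ρ adj ρ≈ with pos-neighbours k q adj
  ... | inj₁ refl = inj₁ ρ≈
  ... | inj₂ refl = inj₂ ρ≈

  F-moves : ∀ k ρ → FS (Cycle n) (Star n) (F k) ρ →
            ρ ≈ F (suc k) ⊎ ρ ≈ F k ∘⟨ pos k ⇄ pos (k + m) ⟩
  F-moves k ρ fs with FS⇒transpose {X = Cycle n} {Star n} {F k} {ρ} fs
  ... | a , b , adj , inj₁ (a↦0 , _) , ρ≈ with F-centre-unique k a a↦0
  ...   | refl = F-centre-moves k b ρ adj ρ≈
  F-moves k ρ fs
      | a , b , adj , inj₂ (b↦0 , _) , ρ≈ with F-centre-unique k b b↦0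
  ...   | refl = F-centre-moves k a ρ (swap adj)
                   λ x → trans (ρ≈ x) (cong (fun (F k)) (transpose-comm a (pos k) x))

  F-backtrack : ∀ k → F (suc k) ∘⟨ pos (suc k) ⇄ pos (suc k + m) ⟩ ≈ F k
  F-backtrack k x = cong (fun (F k)) (begin
    transpose (pos k) (pos (suc k)) (transpose (pos (suc k)) (pos (suc k + m)) x)
      ≡⟨ cong (λ p → transpose (pos k) (pos (suc k)) (transpose (pos (suc k)) p x)) wraps ⟩
    transpose (pos k) (pos (suc k)) (transpose (pos (suc k)) (pos k) x)
      ≡⟨ transpose-inverse (pos k) (pos (suc k)) ⟩
    x ∎)
    where
    open ≡-Reasoning
    wraps : pos (suc k + m) ≡ pos k
    wraps = trans (cong pos (sym (+-suc k m))) (pos-+n k)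

  F-forward-or-back : ∀ k ρ → FS (Cycle n) (Star n) (F (suc k)) ρ →
                      ρ ≈ F (suc (suc k)) ⊎ ρ ≈ F k
  F-forward-or-back k ρ fs with F-moves (suc k) ρ fs
  ... | inj₁ ρ≈ = inj₁ ρ≈
  ... | inj₂ ρ≈ = inj₂ λ x → trans (ρ≈ x) (F-backtrack k x)

  origin-periodic : ∀ k e → origin (n * m + k) e ≡ origin k e
  origin-periodic k zero    = refl
  origin-periodic k (suc e) =
    cong suc (trans (cong (_% m) (x∙yz≈y∙xz e (n * m) k)) (%-remove-+ˡ (e + k) (n∣m*n n)))

  F-periodic : ∀ k → F (n * m + k) ≈ F k
  F-periodic k x with pos-surjective k x
  ... | e , e<n , refl = begin
    fun (F (n * m + k)) (pos (k + e))            ≡⟨ cong (fun (F (n * m + k))) shift ⟨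
    fun (F (n * m + k)) (pos (n * m + k + e))    ≡⟨ F-pos (n * m + k) e e<n ⟩
    fun σ₀ (pos (origin (n * m + k) e))          ≡⟨ cong (fun σ₀ ∘ pos) (origin-periodic k e) ⟩
    fun σ₀ (pos (origin k e))                    ≡⟨ F-pos k e e<n ⟨
    fun (F k) (pos (k + e))                      ∎
    where
    open ≡-Reasoning
    shift : pos (n * m + k + e) ≡ pos (k + e)
    shift = trans (cong pos (+-assoc (n * m) k e)) (pos-+period (k + e))

  F-injective : ∀ a b → F a ≈ F b → a % (n * m) ≡ b % (n * m)
  F-injective a b a≈b = %-≡-chinese a b n m (suc-coprimeTo m) centre-≡ follower-≡
    where
    centre-≡ : a % n ≡ b % n
    centre-≡ = sym (pos-injective b a
      (F-centre-unique a (pos b) (cong toℕ (trans (a≈b (pos b)) (F-centre b)))))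
    follower-≡ : a % m ≡ b % m
    follower-≡ = suc-injective (pos-offset-injective 0 (suc (a % m)) (suc (b % m))
      (s≤s (m%n<n a m)) (s≤s (m%n<n b m)) (proj₁ (proj₂ σ₀) (begin
        fun σ₀ (pos (suc (a % m)))   ≡⟨ F-pos a 1 (s≤s z<s) ⟨
        fun (F a) (pos (a + 1))      ≡⟨ a≈b (pos (a + 1)) ⟩
        fun (F b) (pos (a + 1))      ≡⟨ cong (fun (F b)) (pos-cong _ _ (+-%-congʳ 1 a b n centre-≡)) ⟩
        fun (F b) (pos (b + 1))      ≡⟨ F-pos b 1 (s≤s z<s) ⟩
        fun σ₀ (pos (suc (b % m)))   ∎)))
      where open ≡-Reasoning

lemma4p1 : (n : ℕ) → 3 ≤ n → (σ₀ : Bij n) →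
    ComponentIsoCycle (Cycle n) (Star n) σ₀ (n * (n ∸ 1))
lemma4p1 (suc (suc (suc j))) (s≤s (s≤s (s≤s z≤n))) σ₀ =
  CyclicWalk.component swap _ F F-step F-periodic F-forward-or-back F-injective
  where open CentreWalk j σ₀
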